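{- For every integer $d \ge 4$, $Z_{(2)}(Q_d) = 2^{d-1}$, where $Q_d$ is the $d$-dimensional hypercube.
   Context: $Q_d$ is the $d$-fold Cartesian product $K_2\Box\cdots\Box K_2$ (vertices are binary strings of length $d$, adjacent iff they differ in exactly one coordinate). Let $G=(V,E)$ be a finite simple graph. Color-change rule (zero forcing): given a set of colored vertices, a colored vertex with exactly one uncolored neighbor colors ("forces") that neighbor. Leaks: for a set $L\subseteq V$, placing a leak on each $v\in L$ means attaching to $v$ one new pendant vertex (adjacent only to $v$) which is never initially colored; consequently no vertex of $L$ can ever force a vertex of $V$. A set $S\subseteq V$ is an $\ell$-forcing set if for every $L\subseteq V$ with $|L|\le \ell$, starting with exactly the vertices of $S$ colored and repeatedly applying the color-change rule in the graph with leaks on $L$, every vertex of $V$ eventually becomes colored. $Z_{(\ell)}(G)$ is the minimum size of an $\ell$-forcing set. -}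

module Defs where

open import Data.Nat using (ℕ; zero; suc; _+_; _≤_)
open import Data.Bool using (Bool; true; false; _≟_)
open import Data.Vec using (Vec; []; _∷_)
open import Data.List using (List; length)
open import Data.List.Membership.Propositional using (_∈_; _∉_)
open import Data.List.Relation.Unary.Unique.Propositional using (Unique)
open import Data.Product using (_×_; Σ; _,_)
open import Relation.Binary.PropositionalEquality using (_≡_; _≢_)
open import Relation.Nullary using (yes; no)

record Graph : Set₁ where
  field
    V   : Set
    Adj : V → V → Set

hamming : ∀ {d} → Vec Bool d → Vec Bool d → ℕ
hamming [] [] = 0
hamming (x ∷ xs) (y ∷ ys) with x ≟ y
... | yes _ = hamming xs ys
... | no  _ = suc (hamming xs ys)

Q : ℕ → Graph
Q d = record { V = Vec Bool d ; Adj = λ u v → hamming u v ≡ 1 }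

module _ (G : Graph) where
  open Graph G

  -- A colored vertex u not carrying a leak forces its
  -- neighbor v once all its other neighbors are colored (a leaky vertex
  -- always has an uncolored pendant neighbor, so it never forces a vertex
  -- of V).
  data Colored (S L : List V) : V → Set where
    init  : ∀ {v} → v ∈ S → Colored S L v
    force : ∀ {u v} → Colored S L u → u ∉ L → Adj u v →
            (∀ w → Adj u w → w ≢ v → Colored S L w) →
            Colored S L v

  -- S is an ℓ-forcing set: for every set L of at most ℓ leaks, every vertex
  -- eventually gets colored.  (A list of length ≤ ℓ ranges over exactly the
  -- sets of size ≤ ℓ.)
  IsLeakyForcing : ℕ → List V → Set
  IsLeakyForcing ℓ S = ∀ (L : List V) → length L ≤ ℓ → ∀ v → Colored S L v

  -- Z_(ℓ)(G) = k : k is the minimum size of an ℓ-forcing set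
  -- (sets of vertices are duplicate-free lists; size = length).
  LeakyForcingNumber : ℕ → ℕ → Set
  LeakyForcingNumber ℓ k =
    (Σ (List V) λ S → Unique S × length S ≡ k × IsLeakyForcing ℓ S)
    × (∀ (S : List V) → Unique S → IsLeakyForcing ℓ S → k ≤ length S)

-- Upper bound: the face x₀ = false is a 2-forcing set.  A top vertex true ∷ r is
-- forced by false ∷ r unless false ∷ r carries a leak; then, as d − 1 ≥ 3, r has a
-- neighbour a avoiding the other leak c and all common neighbours of r and c, so
-- true ∷ a gets colored and forces true ∷ r.
--
-- Lower bound, already without leaks: over GF(2) the Laplacian of Q_d is
-- L = A + d·I, and A² = d·I gives L² = 0.  A null vector of L vanishing on the
-- colored vertices vanishes on every forced vertex.  For x on Q_{d-1}, let raise x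
-- be x on the face x₀ = true and 0 elsewhere; then L (raise x) is a null vector
-- equal to x on the face x₀ = false.  A set S of fewer than 2^{d-1} vertices
-- imposes fewer linear conditions than there are unknowns x, so some x ≠ 0 gives
-- a null vector vanishing on S but not on the whole cube: S is not forcing.
module Submission where

open import Defs
open import Data.Nat using (ℕ; _≤_; _^_; _∸_)

open import Algebra.Bundles using (CommutativeRing)
open import Data.Bool using (Bool; true; false; not; _∧_; _xor_; _≟_)
open import Data.Bool.Properties
  using ( ∧-zeroʳ; ∧-identityʳ; ∧-assoc; ∧-idem; ∧-distribˡ-xor; xor-assoc; xor-same
        ; xor-identityˡ; xor-identityʳ; not-involutive; not-¬; ¬-not; xor-∧-commutativeRing )
open import Algebra.Properties.CommutativeSemigroup
  (CommutativeRing.+-commutativeSemigroup xor-∧-commutativeRing) using (interchange)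
open import Data.Empty using (⊥-elim)
open import Data.List using (List; []; _∷_; length; map; _++_)
open import Data.List.Membership.Propositional using (_∈_; _∉_)
open import Data.List.Membership.Propositional.Properties using (∈-map⁺; ∈-map⁻; ∈-++⁺ˡ; ∈-++⁺ʳ)
import Data.List.Membership.DecPropositional as DecMembership
open import Data.List.Properties using (length-map; length-++)
open import Data.List.Relation.Unary.All as All using (All; []; _∷_)
open import Data.List.Relation.Unary.AllPairs using ([]; _∷_)
open import Data.List.Relation.Unary.Any using (here; there)
open import Data.List.Relation.Unary.Unique.Propositional using (Unique)
import Data.List.Relation.Unary.Unique.Propositional.Properties as Unique
open import Data.Nat using (suc; zero; _+_; _<_; z≤n; s≤s)
open import Data.Nat.Properties using (≮⇒≥; suc-injective; +-identityʳ)
open import Data.Product using (∃; _×_; _,_)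
open import Data.Sum using (_⊎_; inj₁; inj₂)
open import Data.Vec using (Vec; []; _∷_; replicate; zipWith; take; drop)
open import Data.Vec.Properties
  using (take-zipWith; drop-zipWith; take++drop≡id; zipWith-identityˡ; ∷-injectiveˡ; ∷-injectiveʳ; ≡-dec)
open import Data.Vec.Membership.Propositional using () renaming (_∈_ to _∈ᵥ_)
open import Data.Vec.Relation.Unary.Any using (here; there)
import Data.Vec.Relation.Unary.Any.Properties as VecAny
open import Function using (_∘_)
open import Relation.Binary.PropositionalEquality
open import Relation.Nullary using (¬_; Dec; yes; no)
open ≡-Reasoning

xor-cancel-middle : ∀ x a y → (x xor a) xor (a xor y) ≡ x xor y
xor-cancel-middle x a y = begin
  (x xor a) xor (a xor y)  ≡⟨ xor-assoc x a (a xor y) ⟩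
  x xor (a xor (a xor y))  ≡⟨ cong (x xor_) (sym (xor-assoc a a y)) ⟩
  x xor ((a xor a) xor y)  ≡⟨ cong (λ t → x xor (t xor y)) (xor-same a) ⟩
  x xor y                  ∎

not-∧-xor : ∀ o y → not o ∧ y ≡ (o ∧ y) xor y
not-∧-xor true  y = sym (xor-same y)
not-∧-xor false y = refl

-- Linear algebra over GF(2)

infixl 6 _⊕_
_⊕_ : ∀ {n} → Vec Bool n → Vec Bool n → Vec Bool n
_⊕_ = zipWith _xor_

Linear : ∀ {n} → (Vec Bool n → Bool) → Set
Linear φ = ∀ a b → φ (a ⊕ b) ≡ φ a xor φ b

e₀ : ∀ {n} → Vec Bool (suc n)
e₀ {n} = true ∷ replicate n false

linear-∷ : ∀ {m} (φ : Vec Bool (suc m) → Bool) → Linear φ →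
           ∀ c xs → φ (c ∷ xs) ≡ (c ∧ φ e₀) xor φ (false ∷ xs)
linear-∷ φ lin false xs = refl
linear-∷ φ lin true  xs =
  trans (cong (φ ∘ (true ∷_)) (sym (zipWith-identityˡ xor-identityˡ xs))) (lin e₀ (false ∷ xs))

record KernelEmbedding {m} (φ : Vec Bool (suc m) → Bool) : Set where
  field
    embed         : Vec Bool m → Vec Bool (suc m)
    embed-⊕       : ∀ a b → embed (a ⊕ b) ≡ embed a ⊕ embed b
    embed-kernel  : ∀ xs → φ (embed xs) ≡ false
    embed-nonzero : ∀ {xs} → true ∈ᵥ xs → true ∈ᵥ embed xs

-- Either the first coordinate is a pivot of φ, or φ ignores it and we recurse on the rest.
kernelEmbedding : ∀ {m} (φ : Vec Bool (suc m) → Bool) → Linear φ → KernelEmbedding φ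
kernelEmbedding φ lin with φ e₀ in pivot
... | true = record
  { embed         = λ xs → φ (false ∷ xs) ∷ xs
  ; embed-⊕       = λ a b → cong (_∷ (a ⊕ b)) (lin (false ∷ a) (false ∷ b))
  ; embed-kernel  = λ xs → let y = φ (false ∷ xs) in begin
      φ (y ∷ xs)                ≡⟨ linear-∷ φ lin y xs ⟩
      (y ∧ φ e₀) xor y          ≡⟨ cong (λ t → (y ∧ t) xor y) pivot ⟩
      (y ∧ true) xor y          ≡⟨ cong (_xor y) (∧-identityʳ y) ⟩
      y xor y                   ≡⟨ xor-same y ⟩
      false                     ∎
  ; embed-nonzero = there
  }
kernelEmbedding {zero} φ lin | false = record
  { embed         = λ _ → false ∷ []
  ; embed-⊕       = λ { [] [] → refl }
  ; embed-kernel  = λ _ → trans (lin e₀ e₀) (xor-same (φ e₀))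
  ; embed-nonzero = λ ()
  }
kernelEmbedding {suc m} φ lin | false = record
  { embed         = embed
  ; embed-⊕       = λ { (a ∷ as) (b ∷ bs) → cong ((a xor b) ∷_) (K.embed-⊕ as bs) }
  ; embed-kernel  = λ { (b ∷ xs) → begin
      φ (b ∷ K.embed xs)                             ≡⟨ linear-∷ φ lin b (K.embed xs) ⟩
      (b ∧ φ e₀) xor φ (false ∷ K.embed xs)          ≡⟨ cong₂ (λ s t → (b ∧ s) xor t) pivot (K.embed-kernel xs) ⟩
      (b ∧ false) xor false                          ≡⟨ cong (_xor false) (∧-zeroʳ b) ⟩
      false                                          ∎ }
  ; embed-nonzero = λ { (here p) → here p ; (there p) → there (K.embed-nonzero p) }
  }
  where
  module K = KernelEmbedding (kernelEmbedding (φ ∘ (false ∷_)) (λ a b → lin (false ∷ a) (false ∷ b)))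
  embed : Vec Bool (suc m) → Vec Bool (suc (suc m))
  embed (b ∷ xs) = b ∷ K.embed xs

commonZero : ∀ {I : Set} n (φ : I → Vec Bool n → Bool) → (∀ i → Linear (φ i)) →
             (S : List I) → length S < n →
             ∃ λ xs → true ∈ᵥ xs × All (λ i → φ i xs ≡ false) S
commonZero (suc m) φ lin []      _         = e₀ , here refl , []
commonZero (suc m) φ lin (i ∷ S) (s≤s |S|<m) =
  let xs , nz , zs = commonZero m (λ j → φ j ∘ embed)
                       (λ j a b → trans (cong (φ j) (embed-⊕ a b)) (lin j _ _)) S |S|<m
  in embed xs , embed-nonzero nz , embed-kernel xs ∷ zs
  where open KernelEmbedding (kernelEmbedding (φ i) (lin i))

-- 2 ^ suc d unfolds to 2 ^ d + (2 ^ d + 0), whence the take after the drop.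
table : ∀ d → Vec Bool (2 ^ d) → Vec Bool d → Bool
table zero    (x ∷ []) []          = x
table (suc d) t        (false ∷ r) = table d (take (2 ^ d) t) r
table (suc d) t        (true  ∷ r) = table d (take (2 ^ d) (drop (2 ^ d) t)) r

table-⊕ : ∀ d a b r → table d (a ⊕ b) r ≡ table d a r xor table d b r
table-⊕ zero    (x ∷ []) (y ∷ []) []          = refl
table-⊕ (suc d) a        b        (false ∷ r) =
  trans (cong (λ t → table d t r) (take-zipWith _xor_ a b)) (table-⊕ d _ _ r)
table-⊕ (suc d) a        b        (true  ∷ r) =
  trans (cong (λ t → table d t r)
              (trans (cong (take (2 ^ d)) (drop-zipWith {m = 2 ^ d} _xor_ a b)) (take-zipWith _xor_ _ _)))
        (table-⊕ d _ _ r)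

true∈take⊎drop : ∀ m {n} (xs : Vec Bool (m + n)) → true ∈ᵥ xs →
                 true ∈ᵥ take m xs ⊎ true ∈ᵥ drop m xs
true∈take⊎drop m xs nz = VecAny.++⁻ (take m xs) (subst (true ∈ᵥ_) (sym (take++drop≡id m xs)) nz)

table-nonzero : ∀ d t → true ∈ᵥ t → ∃ λ r → table d t r ≡ true
table-nonzero zero    (x ∷ []) (here x≡true) = [] , sym x≡true
table-nonzero (suc d) t        nz with true∈take⊎drop (2 ^ d) t nz
... | inj₁ p = let r , e = table-nonzero d _ p in false ∷ r , e
... | inj₂ p with true∈take⊎drop (2 ^ d) (drop (2 ^ d) t) p
...   | inj₁ q = let r , e = table-nonzero d _ q in true ∷ r , e
...   | inj₂ q = ⊥-elim (nothing∈[] _ q)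
  where
  nothing∈[] : (xs : Vec Bool 0) → ¬ true ∈ᵥ xs
  nothing∈[] [] ()

-- The Laplacian of the cube modulo 2

-- (A f) u over GF(2): the parity of f on the neighbours of u.
adjSum : ∀ d → (Vec Bool d → Bool) → Vec Bool d → Bool
adjSum zero    f []      = false
adjSum (suc d) f (b ∷ r) = adjSum d (f ∘ (b ∷_)) r xor f (not b ∷ r)

odd : ℕ → Bool
odd zero    = false
odd (suc n) = not (odd n)

-- Modulo 2, the Laplacian D − A of the d-regular graph Q_d is A + d·I.
laplacian : ∀ d → (Vec Bool d → Bool) → Vec Bool d → Bool
laplacian d f u = adjSum d f u xor (odd d ∧ f u)

Harmonic : ∀ d → (Vec Bool d → Bool) → Set
Harmonic d X = ∀ u → laplacian d X u ≡ false

adjSum-xor : ∀ d {h f g : Vec Bool d → Bool} → (∀ r → h r ≡ f r xor g r) →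
             ∀ u → adjSum d h u ≡ adjSum d f u xor adjSum d g u
adjSum-xor zero    hyp []      = refl
adjSum-xor (suc d) {f = f} {g} hyp (b ∷ r) =
  trans (cong₂ _xor_ (adjSum-xor d (hyp ∘ (b ∷_)) r) (hyp (not b ∷ r)))
        (interchange (adjSum d (f ∘ (b ∷_)) r) (adjSum d (g ∘ (b ∷_)) r) (f (not b ∷ r)) (g (not b ∷ r)))

adjSum-∧ : ∀ d c {h f : Vec Bool d → Bool} → (∀ r → h r ≡ c ∧ f r) →
           ∀ u → adjSum d h u ≡ c ∧ adjSum d f u
adjSum-∧ zero    c hyp []      = sym (∧-zeroʳ c)
adjSum-∧ (suc d) c hyp (b ∷ r) =
  trans (cong₂ _xor_ (adjSum-∧ d c (hyp ∘ (b ∷_)) r) (hyp (not b ∷ r))) (sym (∧-distribˡ-xor c _ _))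

adjSum-adjSum : ∀ d f u → adjSum d (adjSum d f) u ≡ odd d ∧ f u
adjSum-adjSum zero    f []      = refl
adjSum-adjSum (suc d) f (b ∷ r) = begin
  adjSum d (λ r' → adjSum d f₀ r' xor f₁ r') r xor (adjSum d f₁ r xor f (not (not b) ∷ r))
    ≡⟨ cong₂ _xor_ (adjSum-xor d (λ _ → refl) r) (cong (λ c → adjSum d f₁ r xor f (c ∷ r)) (not-involutive b)) ⟩
  (adjSum d (adjSum d f₀) r xor adjSum d f₁ r) xor (adjSum d f₁ r xor f (b ∷ r))
    ≡⟨ cong (λ t → (t xor adjSum d f₁ r) xor (adjSum d f₁ r xor f (b ∷ r))) (adjSum-adjSum d f₀ r) ⟩
  ((odd d ∧ f (b ∷ r)) xor adjSum d f₁ r) xor (adjSum d f₁ r xor f (b ∷ r))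
    ≡⟨ xor-cancel-middle (odd d ∧ f (b ∷ r)) (adjSum d f₁ r) (f (b ∷ r)) ⟩
  (odd d ∧ f (b ∷ r)) xor f (b ∷ r)
    ≡⟨ sym (not-∧-xor (odd d) (f (b ∷ r))) ⟩
  not (odd d) ∧ f (b ∷ r) ∎
  where
  f₀ f₁ : Vec Bool d → Bool
  f₀ = f ∘ (b ∷_)
  f₁ = f ∘ (not b ∷_)

laplacian-xor : ∀ d {h f g : Vec Bool d → Bool} → (∀ r → h r ≡ f r xor g r) →
                ∀ u → laplacian d h u ≡ laplacian d f u xor laplacian d g u
laplacian-xor d {h} {f} {g} hyp u =
  trans (cong₂ _xor_ (adjSum-xor d hyp u) (trans (cong (odd d ∧_) (hyp u)) (∧-distribˡ-xor (odd d) (f u) (g u))))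
        (interchange (adjSum d f u) (adjSum d g u) (odd d ∧ f u) (odd d ∧ g u))

-- (A + d·I)² ≡ A² + d·I ≡ 2d·I ≡ 0 modulo 2, using A² = d·I (adjSum-adjSum).
laplacian-harmonic : ∀ d f → Harmonic d (laplacian d f)
laplacian-harmonic d f u = begin
  adjSum d (λ r → adjSum d f r xor (o ∧ f r)) u xor (o ∧ (adjSum d f u xor (o ∧ f u)))
    ≡⟨ cong₂ _xor_ (adjSum-xor d (λ _ → refl) u) (∧-distribˡ-xor o _ _) ⟩
  (adjSum d (adjSum d f) u xor adjSum d (λ r → o ∧ f r) u) xor ((o ∧ adjSum d f u) xor (o ∧ (o ∧ f u)))
    ≡⟨ cong₂ (λ s t → s xor ((o ∧ adjSum d f u) xor t))
             (cong₂ _xor_ (adjSum-adjSum d f u) (adjSum-∧ d o (λ _ → refl) u))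
             (trans (sym (∧-assoc o o (f u))) (cong (_∧ f u) (∧-idem o))) ⟩
  ((o ∧ f u) xor (o ∧ adjSum d f u)) xor ((o ∧ adjSum d f u) xor (o ∧ f u))
    ≡⟨ xor-cancel-middle (o ∧ f u) (o ∧ adjSum d f u) (o ∧ f u) ⟩
  (o ∧ f u) xor (o ∧ f u)
    ≡⟨ xor-same (o ∧ f u) ⟩
  false ∎
  where
  o : Bool
  o = odd d

hamming-refl : ∀ {d} (r : Vec Bool d) → hamming r r ≡ 0
hamming-refl []          = refl
hamming-refl (true  ∷ r) = hamming-refl r
hamming-refl (false ∷ r) = hamming-refl r

hamming-∷-≡ : ∀ {d} x (r w : Vec Bool d) → hamming (x ∷ r) (x ∷ w) ≡ hamming r w
hamming-∷-≡ true  r w = refl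
hamming-∷-≡ false r w = refl

hamming-∷-≢ : ∀ {d} x y (r w : Vec Bool d) → x ≢ y → hamming (x ∷ r) (y ∷ w) ≡ suc (hamming r w)
hamming-∷-≢ x y r w x≢y with x ≟ y
... | yes x≡y = ⊥-elim (x≢y x≡y)
... | no  _   = refl

hamming≡0⇒≡ : ∀ {d} (r w : Vec Bool d) → hamming r w ≡ 0 → r ≡ w
hamming≡0⇒≡ []      []      _ = refl
hamming≡0⇒≡ (x ∷ r) (y ∷ w) e with x ≟ y
... | yes refl = cong (x ∷_) (hamming≡0⇒≡ r w e)

adjacent-∷-≢ : ∀ {d} x y (r w : Vec Bool d) → x ≢ y → hamming (x ∷ r) (y ∷ w) ≡ 1 → r ≡ w
adjacent-∷-≢ x y r w x≢y adj = hamming≡0⇒≡ r w (suc-injective (trans (sym (hamming-∷-≢ x y r w x≢y)) adj))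

adjacent⇒≢ : ∀ {d} {r w : Vec Bool d} → hamming r w ≡ 1 → r ≢ w
adjacent⇒≢ {r = r} adj refl with () ← trans (sym adj) (hamming-refl r)

adjacent-flipˡ : ∀ {d} x (r : Vec Bool d) → hamming (not x ∷ r) (x ∷ r) ≡ 1
adjacent-flipˡ x r = trans (hamming-∷-≢ (not x) x r r (λ e → not-¬ refl (sym e))) (cong suc (hamming-refl r))

adjacent-flipʳ : ∀ {d} x (r : Vec Bool d) → hamming (x ∷ r) (not x ∷ r) ≡ 1
adjacent-flipʳ x r = trans (hamming-∷-≢ x (not x) r r (not-¬ refl)) (cong suc (hamming-refl r))

adjSum-vanishing : ∀ d X u → (∀ w → hamming u w ≡ 1 → X w ≡ false) → adjSum d X u ≡ false
adjSum-vanishing zero    X []      h = refl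
adjSum-vanishing (suc d) X (b ∷ r) h =
  cong₂ _xor_ (adjSum-vanishing d (X ∘ (b ∷_)) r (λ w e → h (b ∷ w) (trans (hamming-∷-≡ b r w) e)))
              (h (not b ∷ r) (adjacent-flipʳ b r))

adjSum-single : ∀ d X u v → hamming u v ≡ 1 → (∀ w → hamming u w ≡ 1 → w ≢ v → X w ≡ false) →
                adjSum d X u ≡ X v
adjSum-single zero    X []      []        ()  h
adjSum-single (suc d) X (b ∷ r) (b′ ∷ r′) adj h with b ≟ b′
... | yes refl = trans
  (cong₂ _xor_
     (adjSum-single d (X ∘ (b ∷_)) r r′ adj
        (λ w e w≢r′ → h (b ∷ w) (trans (hamming-∷-≡ b r w) e) (w≢r′ ∘ ∷-injectiveʳ)))
     (h (not b ∷ r) (adjacent-flipʳ b r)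
        (λ e → not-¬ refl (sym (∷-injectiveˡ e)))))
  (xor-identityʳ _)
... | no b≢b′ with ¬-not (b≢b′ ∘ sym) | hamming≡0⇒≡ r r′ (suc-injective adj)
...   | refl | refl = cong (_xor X (not b ∷ r))
  (adjSum-vanishing d (X ∘ (b ∷_)) r
     (λ w e → h (b ∷ w) (trans (hamming-∷-≡ b r w) e) (b≢b′ ∘ ∷-injectiveˡ)))

-- Lower bound

harmonic-vanishes : ∀ d X → Harmonic d X → ∀ {S L} → (∀ {s} → s ∈ S → X s ≡ false) →
                    ∀ {v} → Colored (Q d) S L v → X v ≡ false
harmonic-vanishes d X harmonic zero-on-S (init v∈S) = zero-on-S v∈S
harmonic-vanishes d X harmonic zero-on-S (force {u} {v} u-colored _ adj others) = begin
  X v                           ≡⟨ sym (adjSum-single d X u v adj others-zero) ⟩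
  adjSum d X u                  ≡⟨ sym (xor-identityʳ _) ⟩
  adjSum d X u xor false        ≡⟨ cong (adjSum d X u xor_) (sym (trans (cong (odd d ∧_) Xu≡false) (∧-zeroʳ (odd d)))) ⟩
  laplacian d X u               ≡⟨ harmonic u ⟩
  false                         ∎
  where
  Xu≡false : X u ≡ false
  Xu≡false = harmonic-vanishes d X harmonic zero-on-S u-colored
  others-zero : ∀ w → hamming u w ≡ 1 → w ≢ v → X w ≡ false
  others-zero w adj′ w≢v = harmonic-vanishes d X harmonic zero-on-S (others w adj′ w≢v)

raise : ∀ {d} → (Vec Bool d → Bool) → Vec Bool (suc d) → Bool
raise x (false ∷ r) = false
raise x (true  ∷ r) = x r

raise-xor : ∀ {d} {z x y : Vec Bool d → Bool} → (∀ r → z r ≡ x r xor y r) →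
            ∀ u → raise z u ≡ raise x u xor raise y u
raise-xor hyp (false ∷ r) = refl
raise-xor hyp (true  ∷ r) = hyp r

laplacian-raise-bottom : ∀ d x r → laplacian (suc d) (raise x) (false ∷ r) ≡ x r
laplacian-raise-bottom d x r = begin
  (adjSum d (λ _ → false) r xor x r) xor (odd (suc d) ∧ false)
    ≡⟨ cong₂ (λ s t → (s xor x r) xor t) (adjSum-∧ d false {f = λ _ → false} (λ _ → refl) r) (∧-zeroʳ _) ⟩
  x r xor false
    ≡⟨ xor-identityʳ (x r) ⟩
  x r ∎

zeroForcing-lowerBound : ∀ d (S : List (Vec Bool (suc d))) → (∀ v → Colored (Q (suc d)) S [] v) →
                         2 ^ d ≤ length S
zeroForcing-lowerBound d S colored = ≮⇒≥ λ |S|<2^d →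
  let t , t≢0 , zero-on-S = commonZero (2 ^ d) nullVector linear S |S|<2^d
      r , t-at-r = table-nonzero d t t≢0
  in not-¬ refl (begin
    true                                           ≡⟨ sym t-at-r ⟩
    table d t r                                    ≡⟨ sym (laplacian-raise-bottom d (table d t) r) ⟩
    nullVector (false ∷ r) t                       ≡⟨ harmonic-vanishes (suc d) (λ u → nullVector u t)
                                                        (laplacian-harmonic (suc d) _) (All.lookup zero-on-S)
                                                        (colored (false ∷ r)) ⟩
    false                                          ∎)
  where
  nullVector : Vec Bool (suc d) → Vec Bool (2 ^ d) → Bool
  nullVector u t = laplacian (suc d) (raise (table d t)) u
  linear : ∀ u → Linear (nullVector u)
  linear u a b = laplacian-xor (suc d) (raise-xor (table-⊕ d a b)) u

-- Upper bound

allVecs : ∀ d → List (Vec Bool d)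
allVecs zero    = [] ∷ []
allVecs (suc d) = map (false ∷_) (allVecs d) ++ map (true ∷_) (allVecs d)

length-allVecs : ∀ d → length (allVecs d) ≡ 2 ^ d
length-allVecs zero    = refl
length-allVecs (suc d) = begin
  length (map (false ∷_) (allVecs d) ++ map (true ∷_) (allVecs d))
    ≡⟨ length-++ (map (false ∷_) (allVecs d)) ⟩
  length (map (false ∷_) (allVecs d)) + length (map (true ∷_) (allVecs d))
    ≡⟨ cong₂ _+_ (length-map (false ∷_) (allVecs d)) (length-map (true ∷_) (allVecs d)) ⟩
  length (allVecs d) + length (allVecs d)
    ≡⟨ cong₂ _+_ (length-allVecs d) (trans (length-allVecs d) (sym (+-identityʳ (2 ^ d)))) ⟩
  2 ^ d + (2 ^ d + 0) ∎

∈-allVecs : ∀ {d} (r : Vec Bool d) → r ∈ allVecs d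
∈-allVecs []          = here refl
∈-allVecs (false ∷ r) = ∈-++⁺ˡ (∈-map⁺ (false ∷_) (∈-allVecs r))
∈-allVecs (true  ∷ r) = ∈-++⁺ʳ (map (false ∷_) (allVecs _)) (∈-map⁺ (true ∷_) (∈-allVecs r))

allVecs-unique : ∀ d → Unique (allVecs d)
allVecs-unique zero    = [] ∷ []
allVecs-unique (suc d) =
  Unique.++⁺ (Unique.map⁺ ∷-injectiveʳ (allVecs-unique d)) (Unique.map⁺ ∷-injectiveʳ (allVecs-unique d)) disjoint
  where
  disjoint : ∀ {v} → ¬ (v ∈ map (false ∷_) (allVecs d) × v ∈ map (true ∷_) (allVecs d))
  disjoint (v∈₀ , v∈₁) with ∈-map⁻ (false ∷_) v∈₀ | ∈-map⁻ (true ∷_) v∈₁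
  ... | _ , _ , refl | _ , _ , ()

bottomFace : ∀ d → List (Vec Bool (suc d))
bottomFace d = map (false ∷_) (allVecs d)

bottomFace-unique : ∀ d → Unique (bottomFace d)
bottomFace-unique d = Unique.map⁺ ∷-injectiveʳ (allVecs-unique d)

length-bottomFace : ∀ d → length (bottomFace d) ≡ 2 ^ d
length-bottomFace d = trans (length-map (false ∷_) (allVecs d)) (length-allVecs d)

∈-bottomFace : ∀ {d} (r : Vec Bool d) → (false ∷ r) ∈ bottomFace d
∈-bottomFace r = ∈-map⁺ (false ∷_) (∈-allVecs r)

forced-from-below : ∀ {d L} (r : Vec Bool d) → (false ∷ r) ∉ L → Colored (Q (suc d)) (bottomFace d) L (true ∷ r)
forced-from-below {d} {L} r not-leaky =
  force (init (∈-bottomFace r)) not-leaky (adjacent-flipʳ false r) others-colored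
  where
  others-colored : ∀ w → hamming (false ∷ r) w ≡ 1 → w ≢ true ∷ r → Colored (Q (suc d)) (bottomFace d) L w
  others-colored (false ∷ w) _   _    = init (∈-bottomFace w)
  others-colored (true  ∷ w) adj w≢r = ⊥-elim (w≢r (cong (true ∷_) (sym (hamming≡0⇒≡ r w (suc-injective adj)))))

at-most-one-other : ∀ {A : Set} (L : List A) {x} → x ∈ L → length L ≤ 2 →
                    ∃ λ z → ∀ {w} → w ∈ L → w ≡ x ⊎ w ≡ z
at-most-one-other (y ∷ [])          (here refl)         _ = y , λ { (here refl) → inj₁ refl }
at-most-one-other (y ∷ y′ ∷ [])      (here refl)         _ =
  y′ , λ { (here refl) → inj₁ refl ; (there (here refl)) → inj₂ refl }
at-most-one-other (y ∷ y′ ∷ [])      (there (here refl)) _ =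
  y , λ { (here refl) → inj₂ refl ; (there (here refl)) → inj₁ refl }
at-most-one-other (_ ∷ _ ∷ _ ∷ _)    _ (s≤s (s≤s ()))

∃-neighbour-≢ : ∀ {k} (r c : Vec Bool (2 + k)) → ∃ λ a → hamming a r ≡ 1 × a ≢ c
∃-neighbour-≢ (x ∷ r) (y ∷ c) with x ≟ y
... | yes refl = not x ∷ r , adjacent-flipˡ x r , λ e → not-¬ refl (sym (∷-injectiveˡ e))
∃-neighbour-≢ (x ∷ x′ ∷ r) (y ∷ c) | no x≢y =
  x ∷ not x′ ∷ r , trans (hamming-∷-≡ x _ _) (adjacent-flipˡ x′ r) , x≢y ∘ ∷-injectiveˡ

∃-neighbour-avoiding : ∀ {k} (r c : Vec Bool (3 + k)) →
                       ∃ λ a → hamming a r ≡ 1 × a ≢ c × (hamming a c ≡ 1 → c ≡ r)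
∃-neighbour-avoiding (x ∷ r) (y ∷ c) with x ≟ y
... | yes refl =
  not x ∷ r , adjacent-flipˡ x r , (λ e → not-¬ refl (sym (∷-injectiveˡ e))) ,
  λ adj → cong (x ∷_) (sym (adjacent-∷-≢ (not x) x r c (λ e → not-¬ refl (sym e)) adj))
... | no x≢y =
  let a , a~r , a≢c = ∃-neighbour-≢ r c
  in x ∷ a , trans (hamming-∷-≡ x a r) a~r , x≢y ∘ ∷-injectiveˡ ,
     λ adj → ⊥-elim (a≢c (adjacent-∷-≢ x y a c x≢y adj))

_∈?_ : ∀ {n} (v : Vec Bool n) (L : List (Vec Bool n)) → Dec (v ∈ L)
v ∈? L = DecMembership._∈?_ (≡-dec _≟_) v L

bottomFace-leakyForcing : ∀ k → IsLeakyForcing (Q (4 + k)) 2 (bottomFace (3 + k))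
bottomFace-leakyForcing k L |L|≤2 (false ∷ r) = init (∈-bottomFace r)
bottomFace-leakyForcing k L |L|≤2 (true  ∷ r) with (false ∷ r) ∈? L
... | no  r-sealed = forced-from-below r r-sealed
... | yes r-leaky with at-most-one-other L r-leaky |L|≤2
... | b ∷ c , leaks with ∃-neighbour-avoiding r c
... | a , a~r , a≢c , a~c⇒c≡r =
  force (forced-from-below a (sealed (adjacent⇒≢ a~r ∘ ∷-injectiveʳ) (a≢c ∘ ∷-injectiveʳ)))
        (sealed (λ ()) (a≢c ∘ ∷-injectiveʳ)) a~r others-colored
  where
  sealed : ∀ {w} → w ≢ false ∷ r → w ≢ b ∷ c → w ∉ L
  sealed w≢r w≢c w∈L with leaks w∈L
  ... | inj₁ w≡r = w≢r w≡r
  ... | inj₂ w≡c = w≢c w≡c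
  others-colored : ∀ w → hamming (true ∷ a) w ≡ 1 → w ≢ true ∷ r →
                   Colored (Q (4 + k)) (bottomFace (3 + k)) L w
  others-colored (false ∷ w) _   _   = init (∈-bottomFace w)
  others-colored (true  ∷ w) a~w w≢r =
    forced-from-below w (sealed (w≢r ∘ cong (true ∷_) ∘ ∷-injectiveʳ)
                                (λ e → w≢r (cong (true ∷_) (w≡c⇒w≡r (∷-injectiveʳ e)))))
    where
    w≡c⇒w≡r : w ≡ c → w ≡ r
    w≡c⇒w≡r refl = a~c⇒c≡r a~w

proposition22 : (d : ℕ) → 4 ≤ d → LeakyForcingNumber (Q d) 2 (2 ^ (d ∸ 1))
proposition22 (suc (suc (suc (suc k)))) (s≤s (s≤s (s≤s (s≤s z≤n)))) =
  (bottomFace (3 + k) , bottomFace-unique (3 + k) , length-bottomFace (3 + k) , bottomFace-leakyForcing k) ,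
  λ S _ forcing → zeroForcing-lowerBound (3 + k) S (forcing [] z≤n)
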